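{- Let $j := e^{2i\pi/3}$ and let $\mathcal{A} := \{1, -1, j, -j, j^2, -j^2\}$, viewed as a six-letter alphabet. Let $\lambda$ be the $4$-uniform morphism of the free monoid $\mathcal{A}^*$ defined by $$ \begin{array}{rcl} 1 &\mapsto& 1\ \ { -j}\ \ { -j^2}\ \ 1,\\ -1 &\mapsto& -1\ \ j\ \ j^2\ \ { -1},\\ j &\mapsto& j\ \ { -j^2}\ \ { -1}\ \ j,\\ -j &\mapsto& -j\ \ j^2\ \ 1\ \ { -j},\\ j^2 &\mapsto& j^2\ \ { -1}\ \ { -j}\ \ j^2,\\ -j^2 &\mapsto& -j^2\ \ 1\ \ j\ \ { -j^2}, \end{array} $$ (i.e. $\lambda(z) = z\,(-jz)\,(-j^2z)\,z$ for each letter $z$, with products computed in $\mathbb{C}$). Then the sequence of words $(\lambda^k(1))_{k\ge 0}$ converges to an infinite sequence $(u_n)_{n \geq 0}$ (the fixed point of $\lambda$ beginning with $1$), and for every integer $n \geq 0$, $$u_n = (-1)^{s_2(n)} j^n,$$ where $s_2(n)$ denotes the sum of the binary digits of $n$.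
   Context: A morphism on an alphabet $\mathcal{A}$ is a map $\mathcal{A}^* \to \mathcal{A}^*$ that is a homomorphism for concatenation; it is $d$-uniform if each letter is mapped to a word of length $d$. $\lambda^k$ denotes the $k$-th iterate of $\lambda$. Convergence of words to an infinite sequence means that each $\lambda^k(1)$ is a prefix of $\lambda^{k+1}(1)$ and the lengths tend to infinity (simple/prefix convergence). -}

module Defs where

open import Data.Nat using (ℕ; zero; suc; _+_; _%_; _/_)
open import Data.List using (List; []; _∷_; concatMap)
open import Function using (_∘_)

-- The six-letter alphabet {1, -1, j, -j, j², -j²} (j = e^{2iπ/3}),
-- i.e. the sixth roots of unity in ℂ.
data Letter : Set where
  one negOne jj negJ j2 negJ2 : Letter

neg : Letter → Letter
neg one = negOne
neg negOne = one
neg jj = negJ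
neg negJ = jj
neg j2 = negJ2
neg negJ2 = j2

mulJ : Letter → Letter
mulJ one = jj
mulJ negOne = negJ
mulJ jj = j2
mulJ negJ = negJ2
mulJ j2 = one
mulJ negJ2 = negOne

lam-letter : Letter → List Letter
lam-letter one    = one ∷ negJ ∷ negJ2 ∷ one ∷ []
lam-letter negOne = negOne ∷ jj ∷ j2 ∷ negOne ∷ []
lam-letter jj     = jj ∷ negJ2 ∷ negOne ∷ jj ∷ []
lam-letter negJ   = negJ ∷ j2 ∷ one ∷ negJ ∷ []
lam-letter j2     = j2 ∷ negOne ∷ negJ ∷ j2 ∷ []
lam-letter negJ2  = negJ2 ∷ one ∷ jj ∷ negJ2 ∷ []

lam : List Letter → List Letter
lam = concatMap lam-letter

lam^ : ℕ → List Letter → List Letter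
lam^ zero w = w
lam^ (suc k) w = lam (lam^ k w)

iter : {A : Set} → (A → A) → ℕ → A → A
iter f zero x = x
iter f (suc n) x = f (iter f n x)

-- sum of binary digits; the fuel argument (≥ n) ensures termination
s₂-fuel : ℕ → ℕ → ℕ
s₂-fuel zero    n = 0
s₂-fuel (suc f) n = n % 2 + s₂-fuel f (n / 2)

s₂ : ℕ → ℕ
s₂ n = s₂-fuel n n

negPow : ℕ → Letter → Letter
negPow = iter neg

jPow : ℕ → Letter → Letter
jPow = iter mulJ

formula : ℕ → Letter
formula n = negPow (s₂ n) (jPow n one)

-- Reading λ(z) letterwise, its r-th letter (r < 4) is (-1)^{s₂ r} j^r z.  Since
-- s₂ (r + 4m) = s₂ r + s₂ m and j^(r + 4m) = j^r j^m (as j³ = 1), the sequence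
-- u n = (-1)^{s₂ n} j^n satisfies u (r + 4m) = λ(u m)_r, i.e. λ maps the segment
-- u 0 … u (n-1) to u 0 … u (4n-1).  Hence λ^k(1) is the prefix of u of length 4^k.
module Submission where

open import Defs
open import Data.Nat using (ℕ; zero; suc; _+_; _*_; _^_; _%_; _/_; _≤_; _<_; z≤n; s≤s; _<?_)
open import Data.Nat.Properties
open import Data.Nat.DivMod
open import Data.Nat.Divisibility using (divides-refl)
open import Data.Fin as Fin using (Fin; toℕ)
open import Data.List using (List; []; _∷_; _++_; length; lookup; concatMap)
open import Data.List.Relation.Binary.Prefix.Heterogeneous as Prefix using (Prefix)
open import Data.Product using (Σ; ∃; _×_; _,_)
open import Relation.Nullary.Decidable using (True; toWitness)
open import Relation.Binary.PropositionalEquality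
  using (_≡_; refl; sym; trans; cong; cong₂; subst; subst₂; module ≡-Reasoning)

open ≡-Reasoning

/2≤pred : ∀ n {h} → n ≤ suc h → n / 2 ≤ h
/2≤pred zero      _     = z≤n
/2≤pred n@(suc _) n≤1+h = ≤-pred (≤-trans (m/n<m n 2 (s≤s (s≤s z≤n))) n≤1+h)

s₂-fuel-of-zero : ∀ f → s₂-fuel f 0 ≡ 0
s₂-fuel-of-zero zero    = refl
s₂-fuel-of-zero (suc f) = s₂-fuel-of-zero f

s₂-fuel-irrelevant : ∀ f g {n} → n ≤ f → n ≤ g → s₂-fuel f n ≡ s₂-fuel g n
s₂-fuel-irrelevant zero    zero    _   _   = refl
s₂-fuel-irrelevant zero    (suc g) z≤n _   = sym (s₂-fuel-of-zero g)
s₂-fuel-irrelevant (suc f) zero    _   z≤n = s₂-fuel-of-zero f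
s₂-fuel-irrelevant (suc f) (suc g) {n} n≤1+f n≤1+g =
  cong (n % 2 +_) (s₂-fuel-irrelevant f g (/2≤pred n n≤1+f) (/2≤pred n n≤1+g))

s₂-unfold : ∀ n → s₂ n ≡ n % 2 + s₂ (n / 2)
s₂-unfold zero        = refl
s₂-unfold n@(suc n-1) =
  cong (n % 2 +_) (s₂-fuel-irrelevant n-1 (n / 2) (/2≤pred n ≤-refl) ≤-refl)

s₂-+-*2^ : ∀ k {r} → r < 2 ^ k → ∀ m → s₂ (r + m * 2 ^ k) ≡ s₂ r + s₂ m
s₂-+-*2^ zero    {zero}  _        m = cong s₂ (*-identityʳ m)
s₂-+-*2^ zero    {suc _} (s≤s ())
s₂-+-*2^ (suc k) {r} r<2^[1+k] m = begin
  s₂ (r + m * 2 ^ suc k)           ≡⟨ cong (λ x → s₂ (r + x)) m*2^[1+k]≡q*2 ⟩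
  s₂ (r + q * 2)                   ≡⟨ s₂-unfold (r + q * 2) ⟩
  (r + q * 2) % 2 + s₂ ((r + q * 2) / 2)
    ≡⟨ cong₂ _+_ ([m+kn]%n≡m%n r q 2) (cong s₂ [r+q*2]/2≡r/2+q) ⟩
  r % 2 + s₂ (r / 2 + q)           ≡⟨ cong (r % 2 +_) (s₂-+-*2^ k r/2<2^k m) ⟩
  r % 2 + (s₂ (r / 2) + s₂ m)      ≡⟨ +-assoc (r % 2) _ _ ⟨
  r % 2 + s₂ (r / 2) + s₂ m        ≡⟨ cong (_+ s₂ m) (s₂-unfold r) ⟨
  s₂ r + s₂ m                      ∎
  where
  q = m * 2 ^ k

  m*2^[1+k]≡q*2 : m * 2 ^ suc k ≡ q * 2
  m*2^[1+k]≡q*2 = trans (cong (m *_) (*-comm 2 (2 ^ k))) (sym (*-assoc m (2 ^ k) 2))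

  [r+q*2]/2≡r/2+q : (r + q * 2) / 2 ≡ r / 2 + q
  [r+q*2]/2≡r/2+q = trans (+-distrib-/-∣ʳ r (divides-refl q)) (cong (r / 2 +_) (m*n/n≡m q 2))

  r/2<2^k : r / 2 < 2 ^ k
  r/2<2^k = *-cancelʳ-< 2 (r / 2) (2 ^ k)
    (≤-<-trans (m/n*n≤m r 2) (subst (r <_) (*-comm 2 (2 ^ k)) r<2^[1+k]))

module _ {A : Set} where

  iter-+ : ∀ (f : A → A) a b x → iter f (a + b) x ≡ iter f a (iter f b x)
  iter-+ f zero    b x = refl
  iter-+ f (suc a) b x = cong f (iter-+ f a b x)

  iter-comm : ∀ {f g : A → A} → (∀ x → f (g x) ≡ g (f x)) →
              ∀ n x → iter f n (g x) ≡ g (iter f n x)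
  iter-comm     fg zero    x = refl
  iter-comm {f} fg (suc n) x = trans (cong f (iter-comm fg n x)) (fg (iter f n x))

  iter-comm-iter : ∀ {f g : A → A} → (∀ x → f (g x) ≡ g (f x)) →
                   ∀ a b x → iter f a (iter g b x) ≡ iter g b (iter f a x)
  iter-comm-iter fg a b = iter-comm (λ x → sym (iter-comm (λ y → sym (fg y)) b x)) a

  iter-*-1+period : ∀ (f : A → A) p → (∀ x → iter f p x ≡ x) →
                    ∀ n x → iter f (n * suc p) x ≡ iter f n x
  iter-*-1+period f p period zero    x = refl
  iter-*-1+period f p period (suc n) x = cong f (begin
    iter f (p + n * suc p) x              ≡⟨ iter-+ f p (n * suc p) x ⟩
    iter f p (iter f (n * suc p) x)       ≡⟨ period _ ⟩
    iter f (n * suc p) x                  ≡⟨ iter-*-1+period f p period n x ⟩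
    iter f n x                            ∎)

module _ {A : Set} where

  segment : (ℕ → A) → ℕ → ℕ → List A
  segment u m zero    = []
  segment u m (suc n) = u m ∷ segment u (suc m) n

  length-segment : ∀ u m n → length (segment u m n) ≡ n
  length-segment u m zero    = refl
  length-segment u m (suc n) = cong suc (length-segment u (suc m) n)

  lookup-segment : ∀ u m n (i : Fin (length (segment u m n))) →
                   lookup (segment u m n) i ≡ u (m + toℕ i)
  lookup-segment u m (suc n) Fin.zero    = cong u (sym (+-identityʳ m))
  lookup-segment u m (suc n) (Fin.suc i) =
    trans (lookup-segment u (suc m) n i) (cong u (sym (+-suc m (toℕ i))))

  segment-++ : ∀ u m a b → segment u m (a + b) ≡ segment u m a ++ segment u (a + m) b
  segment-++ u m zero    b = refl
  segment-++ u m (suc a) b =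
    cong (u m ∷_) (trans (segment-++ u (suc m) a b)
                         (cong (λ k → segment u (suc m) a ++ segment u k b) (+-suc a m)))

  segment-prefix : ∀ u m {a b} → a ≤ b → Prefix _≡_ (segment u m a) (segment u m b)
  segment-prefix u m {zero}          _         = Prefix.[]
  segment-prefix u m {suc a} {suc b} (s≤s a≤b) = refl Prefix.∷ segment-prefix u (suc m) a≤b

  concatMap-segment : ∀ (σ : A → List A) d u → (∀ m → σ (u m) ≡ segment u (m * d) d) →
                      ∀ m n → concatMap σ (segment u m n) ≡ segment u (m * d) (n * d)
  concatMap-segment σ d u fixed m zero    = refl
  concatMap-segment σ d u fixed m (suc n) = begin
    σ (u m) ++ concatMap σ (segment u (suc m) n)
      ≡⟨ cong₂ _++_ (fixed m) (concatMap-segment σ d u fixed (suc m) n) ⟩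
    segment u (m * d) d ++ segment u (d + m * d) (n * d)
      ≡⟨ segment-++ u (m * d) d (n * d) ⟨
    segment u (m * d) (d + n * d)
      ∎

lam^-segment : ∀ u → (∀ m → lam-letter (u m) ≡ segment u (m * 4) 4) →
               ∀ k → lam^ k (u 0 ∷ []) ≡ segment u 0 (4 ^ k)
lam^-segment u fixed zero    = refl
lam^-segment u fixed (suc k) = begin
  lam (lam^ k (u 0 ∷ []))     ≡⟨ cong lam (lam^-segment u fixed k) ⟩
  lam (segment u 0 (4 ^ k))   ≡⟨ concatMap-segment lam-letter 4 u fixed 0 (4 ^ k) ⟩
  segment u 0 (4 ^ k * 4)     ≡⟨ cong (segment u 0) (*-comm (4 ^ k) 4) ⟩
  segment u 0 (4 ^ suc k)     ∎

j³≡1 : ∀ z → jPow 3 z ≡ z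
j³≡1 one    = refl
j³≡1 negOne = refl
j³≡1 jj     = refl
j³≡1 negJ   = refl
j³≡1 j2     = refl
j³≡1 negJ2  = refl

neg-mulJ-comm : ∀ z → neg (mulJ z) ≡ mulJ (neg z)
neg-mulJ-comm one    = refl
neg-mulJ-comm negOne = refl
neg-mulJ-comm jj     = refl
neg-mulJ-comm negJ   = refl
neg-mulJ-comm j2     = refl
neg-mulJ-comm negJ2  = refl

lam-letter-digits : ∀ z → lam-letter z ≡ segment (λ r → negPow (s₂ r) (jPow r z)) 0 4
lam-letter-digits one    = refl
lam-letter-digits negOne = refl
lam-letter-digits jj     = refl
lam-letter-digits negJ   = refl
lam-letter-digits j2     = refl
lam-letter-digits negJ2  = refl

formula-+-*4 : ∀ {r} → r < 4 → ∀ m → formula (r + m * 4) ≡ negPow (s₂ r) (jPow r (formula m))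
formula-+-*4 {r} r<4 m = begin
  negPow (s₂ (r + m * 4)) (jPow (r + m * 4) one)
    ≡⟨ cong₂ negPow (s₂-+-*2^ 2 r<4 m) jPow-+-*4 ⟩
  negPow (s₂ r + s₂ m) (jPow r (jPow m one))
    ≡⟨ iter-+ neg (s₂ r) (s₂ m) _ ⟩
  negPow (s₂ r) (negPow (s₂ m) (jPow r (jPow m one)))
    ≡⟨ cong (negPow (s₂ r)) (iter-comm-iter neg-mulJ-comm (s₂ m) r _) ⟩
  negPow (s₂ r) (jPow r (formula m))
    ∎
  where
  jPow-+-*4 : jPow (r + m * 4) one ≡ jPow r (jPow m one)
  jPow-+-*4 = trans (iter-+ mulJ r (m * 4) one)
                    (cong (jPow r) (iter-*-1+period mulJ 3 j³≡1 m one))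

lam-letter-formula : ∀ m → lam-letter (formula m) ≡ segment formula (m * 4) 4
lam-letter-formula m = begin
  lam-letter (formula m)
    ≡⟨ lam-letter-digits (formula m) ⟩
  digit 0 ∷ digit 1 ∷ digit 2 ∷ digit 3 ∷ []
    ≡⟨ cong₂ _∷_ (at 0) (cong₂ _∷_ (at 1) (cong₂ _∷_ (at 2) (cong₂ _∷_ (at 3) refl))) ⟨
  segment formula (m * 4) 4
    ∎
  where
  digit : ℕ → Letter
  digit r = negPow (s₂ r) (jPow r (formula m))

  at : ∀ r {r<4 : True (r <? 4)} → formula (r + m * 4) ≡ digit r
  at r {r<4} = formula-+-*4 (toWitness r<4) m

n<m^n : ∀ m → 1 < m → ∀ n → n < m ^ n
n<m^n m         1<m zero    = s≤s z≤n
n<m^n m@(suc _) 1<m (suc n) =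
  ≤-<-trans (n<m^n m 1<m n) (subst (m ^ n <_) (*-comm (m ^ n) m) (m<m*n (m ^ n) m 1<m))
  where instance _ = m^n≢0 m n

mainTheorem1 :
    (∀ k → Prefix _≡_ (lam^ k (one ∷ [])) (lam^ (suc k) (one ∷ [])))
    × (∀ N → ∃ λ K → ∀ k → K ≤ k → N ≤ length (lam^ k (one ∷ [])))
    × Σ (ℕ → Letter) (λ u →
        (∀ k (i : Fin (length (lam^ k (one ∷ [])))) → lookup (lam^ k (one ∷ [])) i ≡ u (toℕ i))
        × (∀ n → u n ≡ formula n))
mainTheorem1 = prefixes , lengths , formula , lookups , λ n → refl
  where
  λ^k[1]≡ : ∀ k → lam^ k (one ∷ []) ≡ segment formula 0 (4 ^ k)
  λ^k[1]≡ = lam^-segment formula lam-letter-formula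

  prefixes : ∀ k → Prefix _≡_ (lam^ k (one ∷ [])) (lam^ (suc k) (one ∷ []))
  prefixes k = subst₂ (Prefix _≡_) (sym (λ^k[1]≡ k)) (sym (λ^k[1]≡ (suc k)))
    (segment-prefix formula 0 (^-monoʳ-≤ 4 (n≤1+n k)))

  lengths : ∀ N → ∃ λ K → ∀ k → K ≤ k → N ≤ length (lam^ k (one ∷ []))
  lengths N = N , λ k N≤k → subst (N ≤_)
    (sym (trans (cong length (λ^k[1]≡ k)) (length-segment formula 0 (4 ^ k))))
    (≤-trans N≤k (<⇒≤ (n<m^n 4 (s≤s (s≤s z≤n)) k)))

  lookups : ∀ k (i : Fin (length (lam^ k (one ∷ [])))) → lookup (lam^ k (one ∷ [])) i ≡ formula (toℕ i)
  lookups k = subst (λ w → ∀ i → lookup w i ≡ formula (toℕ i)) (sym (λ^k[1]≡ k))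
    (lookup-segment formula 0 (4 ^ k))
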